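{- Let $p,p'$ be coprime with $1\le p<p'$ and let $p'/p$ have continued fraction $[c_0,\ldots,c_n]$ with associated parameters $y_k,z_k$. Let $1\le k\le n$ and $1\le r<z_{k+1}$. If $r+z_k<p$, then $\left\lfloor \frac{p'(r+z_k)}{p}\right\rfloor=\left\lfloor \frac{p'r}{p}\right\rfloor+y_k.$
   Context: The continued fraction $[c_0,\ldots,c_n]$ of $p'/p$ satisfies $c_i\ge1$ for $i<n$, $c_n\ge2$, and $p'/p=c_0+1/(c_1+1/(\cdots+1/c_n))$. Define $y_{ -1}=0,y_0=1$, $z_{ -1}=1,z_0=0$, $y_k=c_{k-1}y_{k-1}+y_{k-2}$, $z_k=c_{k-1}z_{k-1}+z_{k-2}$ for $1\le k\le n+1$ (so $y_{n+1}=p'$ and $z_{n+1}=p$). -}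

module Defs where

open import Data.Nat using (ℕ; zero; suc; _+_; _*_)
open import Data.Fin using (Fin; fromℕ<; toℕ)
open import Data.Nat.Properties using (≤-refl)
open import Data.Product using (_×_; _,_)

-- cfFrac m a = (N , D) where N/D is the value of the finite continued
-- fraction [a_0, ..., a_m] = a_0 + 1/(a_1 + 1/( ... + 1/a_m)),
-- computed by  [a] = a/1  and  [a_0, rest] = a_0 + 1/(N'/D') = (a_0 N' + D')/N'.
cfFrac : (m : ℕ) → (Fin (suc m) → ℕ) → ℕ × ℕ
cfFrac zero a = a Fin.zero , 1
  where import Data.Fin as Fin
cfFrac (suc m) a with cfFrac m (λ i → a (Data.Fin.suc i))
... | (N , D) = a Data.Fin.zero * N + D , N

-- Coefficient c_i, extended by 0 outside the range (only used in range).
coef : (n : ℕ) → (Fin (suc n) → ℕ) → ℕ → ℕ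
coef zero c zero = c Data.Fin.zero
coef zero c (suc i) = 0
coef (suc n) c zero = c Data.Fin.zero
coef (suc n) c (suc i) = coef n (λ j → c (Data.Fin.suc j)) i

-- The parameters y_k, z_k, indexed by k+1 (shifted so that index 0 is y_{-1}):
-- yz n c j = (y_{j-1} , z_{j-1}).
-- y_{-1}=0, y_0=1, z_{-1}=1, z_0=0,
-- y_k = c_{k-1} y_{k-1} + y_{k-2},  z_k = c_{k-1} z_{k-1} + z_{k-2}.
yz : (n : ℕ) → (Fin (suc n) → ℕ) → ℕ → (ℕ × ℕ) × (ℕ × ℕ)
-- returns ((y_{j-1}, z_{j-1}) , (y_j , z_j)) for input j
yz n c zero = ((0 , 1) , (1 , 0))
yz n c (suc j) with yz n c j
... | ((y₁ , z₁) , (y₂ , z₂)) =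
  ((y₂ , z₂) , (coef n c j * y₂ + y₁ , coef n c j * z₂ + z₁))

y : (n : ℕ) → (Fin (suc n) → ℕ) → ℕ → ℕ
y n c k with yz n c k
... | (_ , (a , _)) = a

z : (n : ℕ) → (Fin (suc n) → ℕ) → ℕ → ℕ
z n c k with yz n c k
... | (_ , (_ , b)) = b

-- c is a valid continued-fraction expansion of p'/p:
-- c_i ≥ 1 for i < n, c_n ≥ 2, and p'/p = [c_0,...,c_n]
-- (equality of fractions p'/p = N/D, i.e. p' * D = p * N).
open import Data.Nat using (_≤_; _<_)
open import Relation.Binary.PropositionalEquality using (_≡_)

record IsCF (p′ p n : ℕ) (c : Fin (suc n) → ℕ) : Set where
  field
    pos  : (i : Fin (suc n)) → toℕ i < n → 1 ≤ c i
    last : 2 ≤ c (Data.Fin.fromℕ n)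
    val  : let (N , D) = cfFrac n c in p′ * D ≡ p * N

{-# OPTIONS --safe #-}
-- Let N/D = [c_k, …, c_n]. Comparing reduced fractions, p′ = N y_k + D y_{k-1} and
-- p = N z_k + D z_{k-1}, and the determinant y_k z_{k-1} − y_{k-1} z_k = ±1 gives p′ z_k − p y_k = ∓D.
-- Hence p′ (r + z_k) = p′ r + p y_k ∓ D, and the quotient by p grows by exactly y_k unless
-- p′ r lies less than D above (resp. at most D below) a multiple of p. For 1 ≤ r < z_{k+1} this is
-- ruled out by a one-sided best-approximation property: in the basis N, D the gap p′ r − p s has
-- coefficients a ≥ 1 and b ≥ 1 − c_k, so it is at least N − (c_k − 1) D ≥ D; a gap of exactly D
-- in the second case would make p divide p′ (r + z_k).
module Submission where

open import Defs
open import Data.Nat using (ℕ; zero; suc; _+_; _*_; _∸_; _≤_; _<_; _/_; NonZero; >-nonZero; _≤?_)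
open import Data.Nat.Properties
open import Data.Nat.DivMod using (+-distrib-/-∣ʳ; m<n⇒m/n≡0; m*n/n≡m; m≡m%n+[m/n]*n; m%n<n)
open import Data.Nat.Divisibility using (_∣_; divides; n∣m*n; ∣n⇒∣m*n; ∣m+n∣m⇒∣n; ∣1⇒≡1; ∣-antisym; ∣⇒≤)
open import Data.Nat.Coprimality as Coprimality using (Coprime; coprime-divisor)
open import Data.Nat.Tactic.RingSolver using (solve)
open import Data.Fin using (Fin; fromℕ)
import Data.Fin as Fin
open import Data.List using (_∷_; [])
open import Data.Product using (_×_; _,_; proj₁; proj₂)
open import Data.Sum using (_⊎_; inj₁; inj₂)
open import Relation.Nullary using (¬_; yes; no; contradiction)
open import Relation.Binary.PropositionalEquality
  using (_≡_; _≢_; refl; sym; trans; cong; cong₂; subst; module ≡-Reasoning)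

[r+qn]/n≡q : ∀ {r n} q .{{_ : NonZero n}} → r < n → (r + q * n) / n ≡ q
[r+qn]/n≡q {r} {n} q r<n = begin
  (r + q * n) / n    ≡⟨ +-distrib-/-∣ʳ r (n∣m*n q) ⟩
  r / n + q * n / n  ≡⟨ cong₂ _+_ (m<n⇒m/n≡0 r<n) (m*n/n≡m q n) ⟩
  q                  ∎
  where open ≡-Reasoning

[r+qn+kn∸d]/n≡q+k : ∀ r q k d {n} .{{_ : NonZero n}} → r < n → d ≤ r →
                    (r + q * n + k * n ∸ d) / n ≡ q + k
[r+qn+kn∸d]/n≡q+k r q k d {n} r<n d≤r with m≤n⇒∃[o]m+o≡n d≤r
... | e , refl = begin
  (d + e + q * n + k * n ∸ d) / n  ≡⟨ cong (λ t → (t ∸ d) / n) (solve (d ∷ e ∷ q ∷ n ∷ k ∷ [])) ⟩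
  (d + (e + (q + k) * n) ∸ d) / n  ≡⟨ cong (_/ n) (m+n∸m≡n d _) ⟩
  (e + (q + k) * n) / n            ≡⟨ [r+qn]/n≡q (q + k) (≤-<-trans (m≤n+m e d) r<n) ⟩
  q + k                            ∎
  where open ≡-Reasoning

[r+qn+kn+d]/n≡q+k : ∀ r q k d {n} .{{_ : NonZero n}} → r + d < n →
                    (r + q * n + k * n + d) / n ≡ q + k
[r+qn+kn+d]/n≡q+k r q k d {n} r+d<n = begin
  (r + q * n + k * n + d) / n  ≡⟨ cong (_/ n) (solve (r ∷ q ∷ n ∷ k ∷ d ∷ [])) ⟩
  (r + d + (q + k) * n) / n    ≡⟨ [r+qn]/n≡q (q + k) r+d<n ⟩
  q + k                        ∎
  where open ≡-Reasoning

-- Read a = X₁ − W₁ and b = X₀ − W₀ as integers. Then N a + D b = M ≥ 0 and z₀ a − z₁ b = R ≥ 1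
-- force a ≥ 1, R < c z₁ + z₀ then forces b + c ≥ 1, and so M ≥ N + D b ≥ (c + b) D ≥ D.
lattice-gap : ∀ {N D z₀ z₁ c X₁ W₁ X₀ W₀ R M} → c * D ≤ N → 1 ≤ D → 1 ≤ R → R < c * z₁ + z₀ →
              N * X₁ + D * X₀ ≡ N * W₁ + D * W₀ + M →
              z₀ * X₁ + z₁ * W₀ ≡ z₀ * W₁ + z₁ * X₀ + R →
              D ≤ M
lattice-gap {N} {D} {z₀} {z₁} {c} {X₁} {W₁} {X₀} {W₀} {R} {M} cD≤N 1≤D 1≤R R<z value index =
  +-cancelˡ-≤ (N * W₁ + D * W₀ + N) D M (begin
    N * W₁ + D * W₀ + N + D          ≡⟨ solve (N ∷ W₁ ∷ D ∷ W₀ ∷ []) ⟩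
    N * (1 + W₁) + D * (1 + W₀)      ≤⟨ +-mono-≤ (*-monoʳ-≤ N W₁<X₁) (*-monoʳ-≤ D W₀<X₀+c) ⟩
    N * X₁ + D * (X₀ + c)            ≡⟨ solve (N ∷ X₁ ∷ D ∷ X₀ ∷ c ∷ []) ⟩
    N * X₁ + D * X₀ + c * D          ≤⟨ +-monoʳ-≤ (N * X₁ + D * X₀) cD≤N ⟩
    N * X₁ + D * X₀ + N              ≡⟨ cong (_+ N) value ⟩
    N * W₁ + D * W₀ + M + N          ≡⟨ solve (N ∷ W₁ ∷ D ∷ W₀ ∷ M ∷ []) ⟩
    N * W₁ + D * W₀ + N + M          ∎)
  where
  open ≤-Reasoning

  W₁<X₁ : W₁ < X₁
  W₁<X₁ with X₁ ≤? W₁ | W₀ ≤? X₀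
  ... | no X₁≰W₁  | _ = ≰⇒> X₁≰W₁
  ... | yes X₁≤W₁ | yes W₀≤X₀ = contradiction index (<⇒≢ (begin-strict
    z₀ * X₁ + z₁ * W₀      ≤⟨ +-mono-≤ (*-monoʳ-≤ z₀ X₁≤W₁) (*-monoʳ-≤ z₁ W₀≤X₀) ⟩
    z₀ * W₁ + z₁ * X₀      <⟨ m<m+n (z₀ * W₁ + z₁ * X₀) 1≤R ⟩
    z₀ * W₁ + z₁ * X₀ + R  ∎))
  ... | yes X₁≤W₁ | no W₀≰X₀ = contradiction value (<⇒≢ (begin-strict
    N * X₁ + D * X₀        <⟨ +-mono-≤-< (*-monoʳ-≤ N X₁≤W₁) (*-monoʳ-< D {{>-nonZero 1≤D}} (≰⇒> W₀≰X₀)) ⟩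
    N * W₁ + D * W₀        ≤⟨ m≤m+n (N * W₁ + D * W₀) M ⟩
    N * W₁ + D * W₀ + M    ∎))

  W₀<X₀+c : W₀ < X₀ + c
  W₀<X₀+c = *-cancelˡ-< z₁ W₀ (X₀ + c) (+-cancelˡ-< (z₀ * W₁ + z₀) (z₁ * W₀) (z₁ * (X₀ + c)) (begin-strict
    z₀ * W₁ + z₀ + z₁ * W₀             ≡⟨ solve (z₀ ∷ W₁ ∷ z₁ ∷ W₀ ∷ []) ⟩
    z₀ * (1 + W₁) + z₁ * W₀            ≤⟨ +-monoˡ-≤ (z₁ * W₀) (*-monoʳ-≤ z₀ W₁<X₁) ⟩
    z₀ * X₁ + z₁ * W₀                  ≡⟨ index ⟩
    z₀ * W₁ + z₁ * X₀ + R              <⟨ +-monoʳ-< (z₀ * W₁ + z₁ * X₀) R<z ⟩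
    z₀ * W₁ + z₁ * X₀ + (c * z₁ + z₀)  ≡⟨ solve (z₀ ∷ W₁ ∷ z₁ ∷ X₀ ∷ c ∷ []) ⟩
    z₀ * W₁ + z₀ + z₁ * (X₀ + c)       ∎))

equal-reduced-fractions : ∀ {p p′ N D} → Coprime p p′ → Coprime N D → p′ * D ≡ p * N → p′ ≡ N × p ≡ D
equal-reduced-fractions {p} {p′} {N} {D} p⊥p′ N⊥D p′D≡pN =
  ∣-antisym p′∣N N∣p′ , ∣-antisym p∣D D∣p
  where
  p∣D : p ∣ D
  p∣D = coprime-divisor p⊥p′ (divides N (trans p′D≡pN (*-comm p N)))
  D∣p : D ∣ p
  D∣p = coprime-divisor (Coprimality.sym N⊥D) (divides p′ (trans (*-comm N p) (sym p′D≡pN)))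
  N∣p′ : N ∣ p′
  N∣p′ = coprime-divisor N⊥D (divides p (trans (*-comm D p′) p′D≡pN))
  p′∣N : p′ ∣ N
  p′∣N = coprime-divisor (Coprimality.sym p⊥p′) (divides D (trans (sym p′D≡pN) (*-comm p′ D)))

State : Set
State = (ℕ × ℕ) × (ℕ × ℕ)

Unimodular : State → Set
Unimodular ((y₀ , z₀) , (y₁ , z₁)) = y₀ * z₁ + 1 ≡ y₁ * z₀ ⊎ y₁ * z₀ + 1 ≡ y₀ * z₁

module _ {N D c y₀ z₀ y₁ z₁ P Q r : ℕ} (cD≤N : c * D ≤ N) (1≤D : 1 ≤ D)
         (P≡ : P ≡ N * y₁ + D * y₀) (Q≡ : Q ≡ N * z₁ + D * z₀)
         (1≤r : 1 ≤ r) (r<z : r < c * z₁ + z₀) where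
  open ≡-Reasoning

  gap-below : y₀ * z₁ + 1 ≡ y₁ * z₀ → ∀ s {M} → P * r ≡ M + s * Q → D ≤ M
  gap-below det s {M} Pr≡ = lattice-gap {c = c} cD≤N 1≤D 1≤r r<z value index
    where
    value : N * (y₁ * r) + D * (y₀ * r) ≡ N * (z₁ * s) + D * (z₀ * s) + M
    value = begin
      N * (y₁ * r) + D * (y₀ * r)      ≡⟨ solve (N ∷ y₁ ∷ r ∷ D ∷ y₀ ∷ []) ⟩
      (N * y₁ + D * y₀) * r            ≡⟨ cong (_* r) P≡ ⟨
      P * r                            ≡⟨ Pr≡ ⟩
      M + s * Q                        ≡⟨ cong (λ t → M + s * t) Q≡ ⟩
      M + s * (N * z₁ + D * z₀)        ≡⟨ solve (M ∷ s ∷ N ∷ z₁ ∷ D ∷ z₀ ∷ []) ⟩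
      N * (z₁ * s) + D * (z₀ * s) + M  ∎
    index : z₀ * (y₁ * r) + z₁ * (z₀ * s) ≡ z₀ * (z₁ * s) + z₁ * (y₀ * r) + r
    index = begin
      z₀ * (y₁ * r) + z₁ * (z₀ * s)      ≡⟨ solve (z₀ ∷ y₁ ∷ r ∷ z₁ ∷ s ∷ []) ⟩
      y₁ * z₀ * r + z₀ * z₁ * s          ≡⟨ cong (λ t → t * r + z₀ * z₁ * s) det ⟨
      (y₀ * z₁ + 1) * r + z₀ * z₁ * s    ≡⟨ solve (y₀ ∷ z₁ ∷ r ∷ z₀ ∷ s ∷ []) ⟩
      z₀ * (z₁ * s) + z₁ * (y₀ * r) + r  ∎

  gap-above : y₁ * z₀ + 1 ≡ y₀ * z₁ → ∀ s {M} → P * r + M ≡ s * Q → D ≤ M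
  gap-above det s {M} Pr+M≡ = lattice-gap {c = c} cD≤N 1≤D 1≤r r<z value index
    where
    value : N * (z₁ * s) + D * (z₀ * s) ≡ N * (y₁ * r) + D * (y₀ * r) + M
    value = begin
      N * (z₁ * s) + D * (z₀ * s)      ≡⟨ solve (N ∷ z₁ ∷ s ∷ D ∷ z₀ ∷ []) ⟩
      s * (N * z₁ + D * z₀)            ≡⟨ cong (s *_) Q≡ ⟨
      s * Q                            ≡⟨ Pr+M≡ ⟨
      P * r + M                        ≡⟨ cong (λ t → t * r + M) P≡ ⟩
      (N * y₁ + D * y₀) * r + M        ≡⟨ solve (N ∷ y₁ ∷ D ∷ y₀ ∷ r ∷ M ∷ []) ⟩
      N * (y₁ * r) + D * (y₀ * r) + M  ∎
    index : z₀ * (z₁ * s) + z₁ * (y₀ * r) ≡ z₀ * (y₁ * r) + z₁ * (z₀ * s) + r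
    index = begin
      z₀ * (z₁ * s) + z₁ * (y₀ * r)      ≡⟨ solve (z₀ ∷ z₁ ∷ s ∷ y₀ ∷ r ∷ []) ⟩
      z₀ * z₁ * s + y₀ * z₁ * r          ≡⟨ cong (λ t → z₀ * z₁ * s + t * r) det ⟨
      z₀ * z₁ * s + (y₁ * z₀ + 1) * r    ≡⟨ solve (z₀ ∷ z₁ ∷ s ∷ y₁ ∷ r ∷ []) ⟩
      z₀ * (y₁ * r) + z₁ * (z₀ * s) + r  ∎

  P*z₁+D≡y₁*Q : y₀ * z₁ + 1 ≡ y₁ * z₀ → P * z₁ + D ≡ y₁ * Q
  P*z₁+D≡y₁*Q det = begin
    P * z₁ + D                       ≡⟨ cong (λ t → t * z₁ + D) P≡ ⟩
    (N * y₁ + D * y₀) * z₁ + D       ≡⟨ solve (N ∷ y₁ ∷ D ∷ y₀ ∷ z₁ ∷ []) ⟩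
    N * y₁ * z₁ + D * (y₀ * z₁ + 1)  ≡⟨ cong (λ t → N * y₁ * z₁ + D * t) det ⟩
    N * y₁ * z₁ + D * (y₁ * z₀)      ≡⟨ solve (N ∷ y₁ ∷ z₁ ∷ D ∷ z₀ ∷ []) ⟩
    y₁ * (N * z₁ + D * z₀)           ≡⟨ cong (y₁ *_) Q≡ ⟨
    y₁ * Q                           ∎

  P*z₁≡y₁*Q+D : y₁ * z₀ + 1 ≡ y₀ * z₁ → P * z₁ ≡ y₁ * Q + D
  P*z₁≡y₁*Q+D det = begin
    P * z₁                           ≡⟨ cong (_* z₁) P≡ ⟩
    (N * y₁ + D * y₀) * z₁           ≡⟨ solve (N ∷ y₁ ∷ D ∷ y₀ ∷ z₁ ∷ []) ⟩
    N * y₁ * z₁ + D * (y₀ * z₁)      ≡⟨ cong (λ t → N * y₁ * z₁ + D * t) det ⟨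
    N * y₁ * z₁ + D * (y₁ * z₀ + 1)  ≡⟨ solve (N ∷ y₁ ∷ z₁ ∷ D ∷ z₀ ∷ []) ⟩
    y₁ * (N * z₁ + D * z₀) + D       ≡⟨ cong (λ t → y₁ * t + D) Q≡ ⟨
    y₁ * Q + D                       ∎

  module _ .{{_ : NonZero Q}} {s M : ℕ} (Pr≡ : P * r ≡ M + s * Q) (M<Q : M < Q) where

    floor-shift-below : y₀ * z₁ + 1 ≡ y₁ * z₀ → P * (r + z₁) / Q ≡ s + y₁
    floor-shift-below det = begin
      P * (r + z₁) / Q              ≡⟨ cong (_/ Q) P[r+z₁]≡ ⟩
      (M + s * Q + y₁ * Q ∸ D) / Q  ≡⟨ [r+qn+kn∸d]/n≡q+k M s y₁ D M<Q (gap-below det s Pr≡) ⟩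
      s + y₁                        ∎
      where
      P[r+z₁]+D≡ : P * (r + z₁) + D ≡ M + s * Q + y₁ * Q
      P[r+z₁]+D≡ = begin
        P * (r + z₁) + D      ≡⟨ solve (P ∷ r ∷ z₁ ∷ D ∷ []) ⟩
        P * r + (P * z₁ + D)  ≡⟨ cong₂ _+_ Pr≡ (P*z₁+D≡y₁*Q det) ⟩
        M + s * Q + y₁ * Q    ∎
      P[r+z₁]≡ : P * (r + z₁) ≡ M + s * Q + y₁ * Q ∸ D
      P[r+z₁]≡ = trans (sym (m+n∸n≡m (P * (r + z₁)) D)) (cong (_∸ D) P[r+z₁]+D≡)

    floor-shift-above : y₁ * z₀ + 1 ≡ y₀ * z₁ → Coprime Q P → r + z₁ < Q → P * (r + z₁) / Q ≡ s + y₁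
    floor-shift-above det Q⊥P r+z₁<Q = begin
      P * (r + z₁) / Q              ≡⟨ cong (_/ Q) P[r+z₁]≡ ⟩
      (M + s * Q + y₁ * Q + D) / Q  ≡⟨ [r+qn+kn+d]/n≡q+k M s y₁ D (≤∧≢⇒< M+D≤Q M+D≢Q) ⟩
      s + y₁                        ∎
      where
      P[r+z₁]≡ : P * (r + z₁) ≡ M + s * Q + y₁ * Q + D
      P[r+z₁]≡ = begin
        P * (r + z₁)              ≡⟨ *-distribˡ-+ P r z₁ ⟩
        P * r + P * z₁            ≡⟨ cong₂ _+_ Pr≡ (P*z₁≡y₁*Q+D det) ⟩
        M + s * Q + (y₁ * Q + D)  ≡⟨ solve (M ∷ s ∷ Q ∷ y₁ ∷ D ∷ []) ⟩
        M + s * Q + y₁ * Q + D    ∎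

      Pr+[Q∸M]≡ : P * r + (Q ∸ M) ≡ (1 + s) * Q
      Pr+[Q∸M]≡ = begin
        P * r + (Q ∸ M)        ≡⟨ cong (_+ (Q ∸ M)) Pr≡ ⟩
        M + s * Q + (Q ∸ M)    ≡⟨ cong (_+ (Q ∸ M)) (+-comm M (s * Q)) ⟩
        s * Q + M + (Q ∸ M)    ≡⟨ +-assoc (s * Q) M (Q ∸ M) ⟩
        s * Q + (M + (Q ∸ M))  ≡⟨ cong (s * Q +_) (m+[n∸m]≡n (<⇒≤ M<Q)) ⟩
        s * Q + Q              ≡⟨ +-comm (s * Q) Q ⟩
        (1 + s) * Q            ∎

      M+D≤Q : M + D ≤ Q
      M+D≤Q = ≤-trans (+-monoʳ-≤ M (gap-above det (1 + s) Pr+[Q∸M]≡)) (≤-reflexive (m+[n∸m]≡n (<⇒≤ M<Q)))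

      Q∤P[r+z₁] : ¬ Q ∣ P * (r + z₁)
      Q∤P[r+z₁] Q∣P[r+z₁] =
        <⇒≱ r+z₁<Q (∣⇒≤ {{>-nonZero (≤-trans 1≤r (m≤m+n r z₁))}} (coprime-divisor Q⊥P Q∣P[r+z₁]))

      M+D≢Q : M + D ≢ Q
      M+D≢Q M+D≡Q = Q∤P[r+z₁] (divides (1 + s + y₁) (begin
        P * (r + z₁)             ≡⟨ P[r+z₁]≡ ⟩
        M + s * Q + y₁ * Q + D   ≡⟨ solve (M ∷ s ∷ Q ∷ y₁ ∷ D ∷ []) ⟩
        M + D + (s + y₁) * Q     ≡⟨ cong (_+ (s + y₁) * Q) M+D≡Q ⟩
        (1 + s + y₁) * Q         ∎))

  floor-shift : .{{_ : NonZero Q}} → Unimodular ((y₀ , z₀) , (y₁ , z₁)) → Coprime Q P → r + z₁ < Q →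
                P * (r + z₁) / Q ≡ P * r / Q + y₁
  floor-shift (inj₁ det) _   _        =
    floor-shift-below (m≡m%n+[m/n]*n (P * r) Q) (m%n<n (P * r) Q) det
  floor-shift (inj₂ det) Q⊥P r+z₁<Q =
    floor-shift-above (m≡m%n+[m/n]*n (P * r) Q) (m%n<n (P * r) Q) det Q⊥P r+z₁<Q

step : ℕ → State → State
step a ((y₀ , z₀) , (y₁ , z₁)) = (y₁ , z₁) , (a * y₁ + y₀ , a * z₁ + z₀)

initial : State
initial = (0 , 1) , (1 , 0)

-- The state ((y₀ , z₀) , (y₁ , z₁)) acts on fractions N / D as x ↦ (y₁ x + y₀) / (z₁ x + z₀).
möbius : State → ℕ × ℕ → ℕ × ℕ
möbius ((y₀ , z₀) , (y₁ , z₁)) (N , D) = N * y₁ + D * y₀ , N * z₁ + D * z₀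

prepend : ℕ → ℕ × ℕ → ℕ × ℕ
prepend a (N , D) = a * N + D , N

-- cfFrac for coefficient sequences indexed by ℕ, whose tails are simply drop k.
cf : ℕ → (ℕ → ℕ) → ℕ × ℕ
cf zero    a = a 0 , 1
cf (suc m) a = prepend (a 0) (cf m (λ i → a (suc i)))

drop : ℕ → (ℕ → ℕ) → ℕ → ℕ
drop zero    a = a
drop (suc k) a = drop k (λ i → a (suc i))

advance : ℕ → (ℕ → ℕ) → State → State
advance zero    a s = s
advance (suc j) a s = advance j (λ i → a (suc i)) (step (a 0) s)

drop-apply : ∀ k a i → drop k a i ≡ a (k + i)
drop-apply zero    a i = refl
drop-apply (suc k) a i = drop-apply k (λ j → a (suc j)) i

advance-suc : ∀ j a s → advance (suc j) a s ≡ step (a j) (advance j a s)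
advance-suc zero    a s = refl
advance-suc (suc j) a s = advance-suc j (λ i → a (suc i)) (step (a 0) s)

advance-+ : ∀ k j a s → advance (k + j) a s ≡ advance j (drop k a) (advance k a s)
advance-+ zero    j a s = refl
advance-+ (suc k) j a s = advance-+ k j (λ i → a (suc i)) (step (a 0) s)

möbius-initial : ∀ v → möbius initial v ≡ v
möbius-initial (N , D) = cong₂ _,_ N*1+D*0≡N N*0+D*1≡D
  where
  N*1+D*0≡N : N * 1 + D * 0 ≡ N
  N*1+D*0≡N = solve (N ∷ D ∷ [])
  N*0+D*1≡D : N * 0 + D * 1 ≡ D
  N*0+D*1≡D = solve (N ∷ D ∷ [])

möbius-step : ∀ a s v → möbius (step a s) v ≡ möbius s (prepend a v)
möbius-step a ((y₀ , z₀) , (y₁ , z₁)) (N , D) = cong₂ _,_ (regroup y₀ y₁) (regroup z₀ z₁)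
  where
  regroup : ∀ u₀ u₁ → N * (a * u₁ + u₀) + D * u₁ ≡ (a * N + D) * u₁ + N * u₀
  regroup u₀ u₁ = solve (N ∷ D ∷ a ∷ u₀ ∷ u₁ ∷ [])

advance-möbius : ∀ m a s → proj₂ (advance (suc m) a s) ≡ möbius s (cf m a)
advance-möbius zero a ((y₀ , z₀) , (y₁ , z₁)) =
  cong₂ _,_ (cong (a 0 * y₁ +_) (sym (*-identityˡ y₀))) (cong (a 0 * z₁ +_) (sym (*-identityˡ z₀)))
advance-möbius (suc m) a s = trans (advance-möbius m (λ i → a (suc i)) (step (a 0) s))
                                   (möbius-step (a 0) s (cf m (λ i → a (suc i))))

cf-split : ∀ k m a → cf (k + m) a ≡ möbius (advance k a initial) (cf m (drop k a))
cf-split k m a = begin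
  cf (k + m) a                                              ≡⟨ möbius-initial (cf (k + m) a) ⟨
  möbius initial (cf (k + m) a)                             ≡⟨ advance-möbius (k + m) a initial ⟨
  proj₂ (advance (suc (k + m)) a initial)                   ≡⟨ cong (λ j → proj₂ (advance j a initial)) (+-suc k m) ⟨
  proj₂ (advance (k + suc m) a initial)                     ≡⟨ cong proj₂ (advance-+ k (suc m) a initial) ⟩
  proj₂ (advance (suc m) (drop k a) (advance k a initial))  ≡⟨ advance-möbius m (drop k a) (advance k a initial) ⟩
  möbius (advance k a initial) (cf m (drop k a))            ∎
  where open ≡-Reasoning

cf-coprime : ∀ m a → Coprime (proj₁ (cf m a)) (proj₂ (cf m a))
cf-coprime zero    a (_ , i∣1) = ∣1⇒≡1 i∣1
cf-coprime (suc m) a (i∣aN+D , i∣N) =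
  cf-coprime m (λ i → a (suc i)) (i∣N , ∣m+n∣m⇒∣n i∣aN+D (∣n⇒∣m*n (a 0) i∣N))

cf-positive : ∀ m a → 1 ≤ a m → 1 ≤ proj₁ (cf m a) × 1 ≤ proj₂ (cf m a)
cf-positive zero    a 1≤a = 1≤a , ≤-refl
cf-positive (suc m) a 1≤a with cf-positive m (λ i → a (suc i)) 1≤a
... | 1≤N , 1≤D = ≤-trans 1≤D (m≤n+m _ (a 0 * _)) , 1≤N

cf-leading : ∀ m a → a 0 * proj₂ (cf m a) ≤ proj₁ (cf m a)
cf-leading zero    a = ≤-reflexive (*-identityʳ (a 0))
cf-leading (suc m) a = m≤m+n _ _

step-unimodular : ∀ a s → Unimodular s → Unimodular (step a s)
step-unimodular a ((y₀ , z₀) , (y₁ , z₁)) (inj₁ det) = inj₂ (begin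
  (a * y₁ + y₀) * z₁ + 1       ≡⟨ solve (a ∷ y₁ ∷ y₀ ∷ z₁ ∷ []) ⟩
  a * y₁ * z₁ + (y₀ * z₁ + 1)  ≡⟨ cong (a * y₁ * z₁ +_) det ⟩
  a * y₁ * z₁ + y₁ * z₀        ≡⟨ solve (a ∷ y₁ ∷ z₁ ∷ z₀ ∷ []) ⟩
  y₁ * (a * z₁ + z₀)           ∎)
  where open ≡-Reasoning
step-unimodular a ((y₀ , z₀) , (y₁ , z₁)) (inj₂ det) = inj₁ (begin
  y₁ * (a * z₁ + z₀) + 1       ≡⟨ solve (a ∷ y₁ ∷ z₁ ∷ z₀ ∷ []) ⟩
  a * y₁ * z₁ + (y₁ * z₀ + 1)  ≡⟨ cong (a * y₁ * z₁ +_) det ⟩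
  a * y₁ * z₁ + y₀ * z₁        ≡⟨ solve (a ∷ y₁ ∷ z₁ ∷ y₀ ∷ []) ⟩
  (a * y₁ + y₀) * z₁           ∎)
  where open ≡-Reasoning

yz-unimodular : ∀ n c k → Unimodular (yz n c k)
yz-unimodular n c zero    = inj₁ refl
yz-unimodular n c (suc k) = step-unimodular (coef n c k) (yz n c k) (yz-unimodular n c k)

yz≡advance : ∀ n c j → yz n c j ≡ advance j (coef n c) initial
yz≡advance n c zero    = refl
yz≡advance n c (suc j) = trans (cong (step (coef n c j)) (yz≡advance n c j))
                               (sym (advance-suc j (coef n c) initial))

cfFrac≡cf : ∀ n c → cfFrac n c ≡ cf n (coef n c)
cfFrac≡cf zero    c = refl
cfFrac≡cf (suc n) c rewrite cfFrac≡cf n (λ i → c (Fin.suc i)) = refl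

coef-last : ∀ n c → coef n c n ≡ c (fromℕ n)
coef-last zero    c = refl
coef-last (suc n) c = coef-last n (λ j → c (Fin.suc j))

lemmaE7 : (p p′ n : ℕ) → (c : Fin (suc n) → ℕ) →
          Coprime p p′ → 1 ≤ p → p < p′ → IsCF p′ p n c →
          (k r : ℕ) → 1 ≤ k → k ≤ n → 1 ≤ r → r < z n c (suc k) →
          r + z n c k < p →
          ∀ .{{_ : Data.Nat.NonZero p}} →
          (p′ * (r + z n c k)) / p ≡ (p′ * r) / p + y n c k
lemmaE7 p p′ n c p⊥p′ _ _ isCF k r _ k≤n 1≤r r<z r+z<p =
  floor-shift {c = a k} leading 1≤D (proj₁ p′,p≡) (proj₂ p′,p≡) 1≤r r<z (yz-unimodular n c k) p⊥p′ r+z<p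
  where
  a : ℕ → ℕ
  a = coef n c
  S : State
  S = yz n c k
  tail : ℕ × ℕ
  tail = cf (n ∸ k) (drop k a)

  split : cf n a ≡ möbius S tail
  split = begin
    cf n a                             ≡⟨ cong (λ j → cf j a) (m+[n∸m]≡n k≤n) ⟨
    cf (k + (n ∸ k)) a                 ≡⟨ cf-split k (n ∸ k) a ⟩
    möbius (advance k a initial) tail  ≡⟨ cong (λ s → möbius s tail) (yz≡advance n c k) ⟨
    möbius S tail                      ∎
    where open ≡-Reasoning

  p′,p≡ : p′ ≡ proj₁ (möbius S tail) × p ≡ proj₂ (möbius S tail)
  p′,p≡ = equal-reduced-fractions p⊥p′
    (subst (λ v → Coprime (proj₁ v) (proj₂ v)) split (cf-coprime n a))
    (subst (λ v → p′ * proj₂ v ≡ p * proj₁ v) (trans (cfFrac≡cf n c) split) (IsCF.val isCF))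

  leading : a k * proj₂ tail ≤ proj₁ tail
  leading = subst (λ t → t * proj₂ tail ≤ proj₁ tail)
                  (trans (drop-apply k a 0) (cong a (+-identityʳ k)))
                  (cf-leading (n ∸ k) (drop k a))

  1≤D : 1 ≤ proj₂ tail
  1≤D = proj₂ (cf-positive (n ∸ k) (drop k a) (subst (1 ≤_) last≡ (≤-trans (n≤1+n 1) (IsCF.last isCF))))
    where
    last≡ : c (fromℕ n) ≡ drop k a (n ∸ k)
    last≡ = sym (trans (drop-apply k a (n ∸ k)) (trans (cong a (m+[n∸m]≡n k≤n)) (coef-last n c)))
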